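{- Let $p$ be a Q-point on $\omega$. Then every element of $\mathscr F^p$ generates a free subsemigroup of $\beta\omega$; that is, for every $u\in\mathscr F^p$ and all $n,m\in\mathbb N$, $u^n=u^m$ holds if and only if $n=m$.
   Context: $\beta\omega$ is the set of ultrafilters on $\omega=\{0,1,2,\dots\}$, and $\mathbb N=\{1,2,\dots\}$. For $u,v\in\beta\omega$, $u+v=\{A\subseteq\omega : \{x\in\omega : \{y\in\omega : x+y\in A\}\in v\}\in u\}$, and $u^n=u+\cdots+u$ ($n$ summands). A Q-point is a nonprincipal ultrafilter $u$ on $\omega$ such that for every partition of $\omega$ into finite sets $F_n$ ($n<\omega$) there is $A\in u$ with $|A\cap F_n|\le 1$ for all $n$. For $u\in\beta\omega$ and a sequence $\langle u_n : n<\omega\rangle$ in $\beta\omega$, the Blass–Frolík sum is the ultrafilter on $\omega\times\omega$ given by $\{A\subseteq\omega\times\omega : \{n : \{m : (n,m)\in A\}\in u_n\}\in u\}$, and the indexed sum $\bigoplus_{u} u_n$ is its image under the map $(n,m)\mapsto n+m$, i.e. $\{A\subseteq\omega : \{n : \{m : n+m\in A\}\in u_n\}\in u\}$. For $p\in\beta\omega$ define $\mathscr F^p_0=\{p\}$, $\mathscr F^p_{\alpha+1}=\{\bigoplus_u u_n : u\in\mathscr F^p_\alpha \text{ and } u_n\in\mathscr F^p_\alpha\text{ for all } n<\omega\}$, $\mathscr F^p_\alpha=\bigcup_{\xi<\alpha}\mathscr F^p_\xi$ for limit $\alpha$, and $\mathscr F^p=\bigcup_{\alpha\in\mathbf{Ord}}\mathscr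 F^p_\alpha$. -}

module Defs where

open import Level using (0ℓ)
open import Data.Nat using (ℕ; zero; suc; _+_; _<_; NonZero)
open import Data.Product using (Σ; ∃; _×_)
open import Data.Sum using (_⊎_)
open import Relation.Nullary using (¬_)
open import Relation.Unary using (Pred; _⊆_; _∩_; ∅; ∁; _∈_)
open import Relation.Binary.PropositionalEquality using (_≡_)

-- Subsets of ω = ℕ are predicates; a "family" of subsets is a predicate on subsets.
-- Points of βω are families satisfying IsUltrafilter.
Family : Set₁
Family = Pred (Pred ℕ 0ℓ) 0ℓ

record IsUltrafilter (u : Family) : Set₁ where
  field
    upward : ∀ (A B : Pred ℕ 0ℓ) → A ⊆ B → u A → u B
    inter  : ∀ (A B : Pred ℕ 0ℓ) → u A → u B → u (A ∩ B)
    proper : ¬ u ∅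
    ultra  : ∀ (A : Pred ℕ 0ℓ) → u A ⊎ u (∁ A)

_≈_ : Family → Family → Set₁
u ≈ v = ∀ (A : Pred ℕ 0ℓ) → (u A → v A) × (v A → u A)

infix 4 _≈_

_⊹_ : Family → Family → Family
(u ⊹ v) A = u (λ x → v (λ y → A (x + y)))

infixr 6 _⊹_

pow : (n : ℕ) → .{{NonZero n}} → Family → Family
pow (suc zero) u = u
pow (suc (suc n)) u = u ⊹ pow (suc n) u

⨁ : Family → (ℕ → Family) → Family
⨁ u us A = u (λ n → us n (λ m → A (n + m)))

-- Q-point. A partition of ω into finite sets F_n (n<ω) is given by the
-- index map f : ℕ → ℕ (x ∈ F_(f x)), with every fibre F_n = f⁻¹{n} finite.
IsQPoint : Family → Set₁
IsQPoint u =
  IsUltrafilter u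
  × (∀ (k : ℕ) → ¬ u (λ x → x ≡ k))
  × (∀ (f : ℕ → ℕ) →
       (∀ (n : ℕ) → ∃ λ b → ∀ (x : ℕ) → f x ≡ n → x < b) →
       Σ (Pred ℕ 0ℓ) λ A → u A × (∀ (x y : ℕ) → x ∈ A → y ∈ A → f x ≡ f y → x ≡ y))

-- 𝓕^p: the union over all ordinals of the hierarchy 𝓕^p_α, i.e. the least
-- family of ultrafilters containing p and closed under indexed sums
-- (membership taken up to equality of ultrafilters, _≈_).
data Inℱ (p : Family) : Family → Set₁ where
  base : ∀ {v} → v ≈ p → Inℱ p v
  sum  : ∀ {v} (u : Family) (us : ℕ → Family) →
         Inℱ p u → (∀ n → Inℱ p (us n)) → v ≈ ⨁ u us → Inℱ p v

{-# OPTIONS --safe #-}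

-- Selecting one point from each dyadic block [2ᵏ - 1, 2ᵏ⁺¹ - 1) and keeping the blocks
-- of one parity, a Q-point p contains a lacunary set A (a < b in A implies 2a < b).
-- Sums a₁ + ⋯ + aᵣ of increasing elements of A then determine their summands, since
-- each summand exceeds the sum of the earlier ones. Every member w of 𝓕ᵖ contains, for
-- every K, the sums with all summands above K, together with a set of such sums
-- containing no pair x, x + s with s a sum of summands above x; indexed sums preserve
-- this, by uniqueness of the summands. Then w ≈ w + v is impossible for such w and v:
-- the set would contain some x together with x + y for a sum y above x. As
-- uᵐ⁺ᵏ ≈ uᵐ + uᵏ, the powers of u are pairwise distinct.
module Submission where

open import Level using (0ℓ)
open import Defs
open import Data.Nat using (ℕ; NonZero; zero; suc; _+_; _^_; _≤_; _<_; s<s⁻¹; _<?_; parity)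
open import Data.Nat.Properties
open import Data.Parity.Base using (Parity; 0ℙ; 1ℙ)
open import Data.Parity.Properties using (p≢p⁻¹; suc-homo-⁻¹)
open import Data.Product using (_×_; ∃-syntax; _,_; proj₁; proj₂)
open import Data.Sum using (_⊎_; inj₁; inj₂; map; map₂)
open import Data.Empty using (⊥-elim)
open import Relation.Nullary using (¬_; yes; no)
open import Relation.Unary using (Pred; _⊆_; ∅; ∁; Empty)
open import Relation.Binary using (tri<; tri≈; tri>)
open import Relation.Binary.PropositionalEquality
  using (_≡_; _≢_; refl; sym; trans; cong; subst)

open IsUltrafilter

≈-refl : ∀ {u} → u ≈ u
≈-refl A = (λ uA → uA) , (λ uA → uA)

≈-sym : ∀ {u v} → u ≈ v → v ≈ u
≈-sym u≈v A = proj₂ (u≈v A) , proj₁ (u≈v A)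

≈-trans : ∀ {u v w} → u ≈ v → v ≈ w → u ≈ w
≈-trans u≈v v≈w A = (λ uA → proj₁ (v≈w A) (proj₁ (u≈v A) uA))
                  , (λ wA → proj₂ (u≈v A) (proj₂ (v≈w A) wA))

isUltrafilter-resp-≈ : ∀ {u v} → u ≈ v → IsUltrafilter u → IsUltrafilter v
isUltrafilter-resp-≈ u≈v U = record
  { upward = λ A B A⊆B vA → to B (upward U A B A⊆B (from A vA))
  ; inter  = λ A B vA vB → to _ (inter U A B (from A vA) (from B vB))
  ; proper = λ v∅ → proper U (from ∅ v∅)
  ; ultra  = λ A → map (to A) (to (∁ A)) (ultra U A)
  }
  where
  to   = λ A → proj₁ (u≈v A)
  from = λ A → proj₂ (u≈v A)

NonPrincipal : Family → Set
NonPrincipal u = ∀ k → ¬ u (λ x → x ≡ k)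

module _ {u : Family} (U : IsUltrafilter u) where

  Empty⇒∉ : ∀ {A} → Empty A → ¬ u A
  Empty⇒∉ {A} A-empty uA = proper U (upward U A ∅ (λ {x} → A-empty x) uA)

  ∉⇒∁∈ : ∀ {A} → ¬ u A → u (∁ A)
  ∉⇒∁∈ {A} A∉u with ultra U A
  ... | inj₁ A∈u  = ⊥-elim (A∉u A∈u)
  ... | inj₂ ∁A∈u = ∁A∈u

  monochromatic-∈ : (colour : ℕ → Parity) → ∃[ π ] u (λ x → colour x ≡ π)
  monochromatic-∈ colour with ultra U (λ x → colour x ≡ 0ℙ)
  ... | inj₁ even = 0ℙ , even
  ... | inj₂ odd  = 1ℙ , upward U _ _ (λ {x} → ≢0ℙ⇒≡1ℙ) odd
    where
    ≢0ℙ⇒≡1ℙ : ∀ {π} → π ≢ 0ℙ → π ≡ 1ℙ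
    ≢0ℙ⇒≡1ℙ {0ℙ} π≢0ℙ = ⊥-elim (π≢0ℙ refl)
    ≢0ℙ⇒≡1ℙ {1ℙ} _    = refl

  nonPrincipal⇒≤∉ : NonPrincipal u → ∀ K → ¬ u (_≤ K)
  nonPrincipal⇒≤∉ np zero ≤0∈u = np 0 (upward U _ _ n≤0⇒n≡0 ≤0∈u)
  nonPrincipal⇒≤∉ np (suc K) ≤1+K∈u =
    np (suc K) (upward U _ _ (λ (x≤1+K , x≰K) → ≤-antisym x≤1+K (≰⇒> x≰K))
                 (inter U _ _ ≤1+K∈u (∉⇒∁∈ (nonPrincipal⇒≤∉ np K))))

  nonPrincipal⇒>∈ : NonPrincipal u → ∀ K → u (K <_)
  nonPrincipal⇒>∈ np K = upward U _ _ ≰⇒> (∉⇒∁∈ (nonPrincipal⇒≤∉ np K))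

⨁-isUltrafilter : ∀ {u us} → IsUltrafilter u → (∀ n → IsUltrafilter (us n)) →
                  IsUltrafilter (⨁ u us)
⨁-isUltrafilter {u} {us} U Us = record
  { upward = λ A B A⊆B → upward U _ _ (λ {n} → upward (Us n) _ _ A⊆B)
  ; inter  = λ A B A∈ B∈ →
      upward U _ _ (λ {n} (An , Bn) → inter (Us n) _ _ An Bn) (inter U _ _ A∈ B∈)
  ; proper = λ ∅∈ → proper U (upward U _ ∅ (λ {n} → proper (Us n)) ∅∈)
  ; ultra  = λ A → map₂ (upward U _ _ (λ {n} → ∉⇒∁∈ (Us n)))
                         (ultra U (λ n → us n (λ m → A (n + m))))
  }

⊹-isUltrafilter : ∀ {u v} → IsUltrafilter u → IsUltrafilter v → IsUltrafilter (u ⊹ v)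
⊹-isUltrafilter U V = ⨁-isUltrafilter U (λ _ → V)

⊹-congˡ : ∀ {u v v′} → IsUltrafilter u → v ≈ v′ → u ⊹ v ≈ u ⊹ v′
⊹-congˡ U v≈v′ A = upward U _ _ (λ {x} → proj₁ (v≈v′ (λ y → A (x + y))))
                 , upward U _ _ (λ {x} → proj₂ (v≈v′ (λ y → A (x + y))))

⊹-assoc : ∀ {u v w} → IsUltrafilter u → IsUltrafilter v → IsUltrafilter w →
          (u ⊹ v) ⊹ w ≈ u ⊹ (v ⊹ w)
⊹-assoc U V W A =
    upward U _ _ (λ {a} → upward V _ _ (λ {b} → upward W _ _ (λ {y} →
      subst A (+-assoc a b y))))
  , upward U _ _ (λ {a} → upward V _ _ (λ {b} → upward W _ _ (λ {y} →
      subst A (sym (+-assoc a b y)))))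

m<n⇒∃[o]n≡m+1+o : ∀ {m n} → m < n → ∃[ o ] n ≡ m + suc o
m<n⇒∃[o]n≡m+1+o {m} m<n = let o , m+1+o≡n = m≤n⇒∃[o]m+o≡n m<n in
  o , trans (sym m+1+o≡n) (sym (+-suc m o))

module _ {u : Family} (U : IsUltrafilter u) where

  pow-isUltrafilter : ∀ n → IsUltrafilter (pow (suc n) u)
  pow-isUltrafilter zero    = U
  pow-isUltrafilter (suc n) = ⊹-isUltrafilter U (pow-isUltrafilter n)

  pow-+ : ∀ m n → pow (suc m + suc n) u ≈ pow (suc m) u ⊹ pow (suc n) u
  pow-+ zero    n = ≈-refl
  pow-+ (suc m) n = ≈-trans (⊹-congˡ U (pow-+ m n))
    (≈-sym (⊹-assoc U (pow-isUltrafilter m) (pow-isUltrafilter n)))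

  module _ (no-absorption : ∀ m n → ¬ pow (suc m) u ≈ pow (suc m) u ⊹ pow (suc n) u) where

    pow-≉-longer : ∀ {m n} → m < n → ¬ pow (suc m) u ≈ pow (suc n) u
    pow-≉-longer {m} m<n uᵐ≈uⁿ with m<n⇒∃[o]n≡m+1+o m<n
    ... | o , refl = no-absorption m o (≈-trans uᵐ≈uⁿ (pow-+ m o))

    pow-injective : ∀ m n .{{_ : NonZero m}} .{{_ : NonZero n}} → pow m u ≈ pow n u → m ≡ n
    pow-injective (suc m) (suc n) uᵐ≈uⁿ with <-cmp m n
    ... | tri≈ _ m≡n _ = cong suc m≡n
    ... | tri< m<n _ _ = ⊥-elim (pow-≉-longer m<n uᵐ≈uⁿ)
    ... | tri> _ _ n<m = ⊥-elim (pow-≉-longer n<m (≈-sym uᵐ≈uⁿ))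

dyadic-bracket : ∀ n → ∃[ k ] 2 ^ k ≤ suc n × suc n < 2 ^ suc k
dyadic-bracket zero = 0 , ≤-refl , n<1+n 1
dyadic-bracket (suc n) with dyadic-bracket n
... | k , 2^k≤1+n , 1+n<2^1+k with 2 + n <? 2 ^ suc k
...   | yes 2+n<2^1+k = k , m≤n⇒m≤1+n 2^k≤1+n , 2+n<2^1+k
...   | no  2+n≮2^1+k = suc k , ≮⇒≥ 2+n≮2^1+k , 2+n<2^2+k
  where
  open ≤-Reasoning
  2+n<2^2+k : 2 + n < 2 ^ suc (suc k)
  2+n<2^2+k = begin-strict
    2 + n                   ≤⟨ 1+n<2^1+k ⟩
    2 ^ suc k               <⟨ m<m+n (2 ^ suc k) (m^n>0 2 (suc k)) ⟩
    2 ^ suc k + 2 ^ suc k   ≡⟨ cong (2 ^ suc k +_) (+-identityʳ (2 ^ suc k)) ⟨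
    2 ^ suc (suc k)         ∎

block : ℕ → ℕ
block n = proj₁ (dyadic-bracket n)

2^block≤1+n : ∀ n → 2 ^ block n ≤ suc n
2^block≤1+n n = proj₁ (proj₂ (dyadic-bracket n))

1+n<2^1+block : ∀ n → suc n < 2 ^ suc (block n)
1+n<2^1+block n = proj₂ (proj₂ (dyadic-bracket n))

block-fibres-bounded : ∀ k → ∃[ b ] ∀ x → block x ≡ k → x < b
block-fibres-bounded k = 2 ^ suc k , λ { x refl → <-trans (n<1+n x) (1+n<2^1+block x) }

block<⇒< : ∀ {a b} → block a < block b → a < b
block<⇒< {a} {b} ba<bb = s<s⁻¹ (begin-strict
    suc a                <⟨ 1+n<2^1+block a ⟩
    2 ^ suc (block a)    ≤⟨ ^-monoʳ-≤ 2 ba<bb ⟩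
    2 ^ block b          ≤⟨ 2^block≤1+n b ⟩
    suc b                ∎)
  where open ≤-Reasoning

2+block≤⇒+< : ∀ {a b} → 2 + block a ≤ block b → a + a < b
2+block≤⇒+< {a} {b} gap = s<s⁻¹ (begin-strict
    suc (a + a)                       <⟨ n<1+n (suc (a + a)) ⟩
    suc (suc (a + a))                 ≡⟨ cong suc (+-suc a a) ⟨
    suc a + suc a                     <⟨ +-mono-< (1+n<2^1+block a) (1+n<2^1+block a) ⟩
    2 ^ suc (block a) + 2 ^ suc (block a)
      ≡⟨ cong (2 ^ suc (block a) +_) (+-identityʳ (2 ^ suc (block a))) ⟨
    2 ^ (2 + block a)                 ≤⟨ ^-monoʳ-≤ 2 gap ⟩
    2 ^ block b                       ≤⟨ 2^block≤1+n b ⟩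
    suc b                             ∎)
  where open ≤-Reasoning

parity[1+n]≢parity[n] : ∀ n → parity (suc n) ≢ parity n
parity[1+n]≢parity[n] n same = p≢p⁻¹ (parity (suc n)) (trans same (sym (suc-homo-⁻¹ n)))

Lacunary : Pred ℕ 0ℓ → Set
Lacunary A = ∀ {a b} → A a → A b → a < b → a + a < b

qPoint⇒lacunary : ∀ {p} → IsQPoint p → ∃[ A ] p A × Lacunary A
qPoint⇒lacunary (P , _ , select)
  with select block block-fibres-bounded | monochromatic-∈ P (λ x → parity (block x))
... | S , S∈p , S-selects | π , π∈p = A , inter P _ _ S∈p π∈p , A-lacunary
  where
  A : Pred ℕ 0ℓ
  A x = S x × parity (block x) ≡ π

  A-lacunary : Lacunary A
  A-lacunary {a} {b} (a∈S , aπ) (b∈S , bπ) a<b with <-cmp (block a) (block b)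
  ... | tri≈ _ same-block _ = ⊥-elim (<⇒≢ a<b (S-selects a b a∈S b∈S same-block))
  ... | tri> _ _ later      = ⊥-elim (<-asym a<b (block<⇒< later))
  ... | tri< earlier _ _ with m≤n⇒m<n∨m≡n earlier
  ...   | inj₁ gap      = 2+block≤⇒+< {a} gap
  ...   | inj₂ adjacent =
    ⊥-elim (parity[1+n]≢parity[n] (block a) (trans (cong parity adjacent) (trans bπ (sym aπ))))

module Chains {A : Pred ℕ 0ℓ} (A-lacunary : Lacunary A) where

  -- Chain K c z: z = a₁ + ⋯ + aᵣ for some K < a₁ < ⋯ < aᵣ = c in A.
  data Chain (K : ℕ) : ℕ → ℕ → Set where
    single : ∀ {a} → A a → K < a → Chain K a a
    snoc   : ∀ {c z a} → Chain K c z → A a → c < a → Chain K a (z + a)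

  ChainSum : ℕ → Pred ℕ 0ℓ
  ChainSum K z = ∃[ c ] Chain K c z

  top∈A : ∀ {K c z} → Chain K c z → A c
  top∈A (single a∈A _) = a∈A
  top∈A (snoc _ a∈A _) = a∈A

  top≤sum : ∀ {K c z} → Chain K c z → c ≤ z
  top≤sum (single _ _)               = ≤-refl
  top≤sum (snoc {z = z} {a = a} _ _ _) = m≤n+m a z

  floor+sum<top+top : ∀ {K c z} → Chain K c z → K + z < c + c
  floor+sum<top+top (single _ K<a) = +-mono-<-≤ K<a ≤-refl
  floor+sum<top+top {K} (snoc {c} {z} {a} chain a∈A c<a) = begin-strict
    K + (z + a)  ≡⟨ +-assoc K z a ⟨
    K + z + a    <⟨ +-monoˡ-< a (<-trans (floor+sum<top+top chain) c+c<a) ⟩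
    a + a        ∎
    where
    open ≤-Reasoning
    c+c<a : c + c < a
    c+c<a = A-lacunary (top∈A chain) a∈A c<a

  lower-floor : ∀ {K K′ c z} → K′ ≤ K → Chain K c z → Chain K′ c z
  lower-floor K′≤K (single a∈A K<a)   = single a∈A (≤-<-trans K′≤K K<a)
  lower-floor K′≤K (snoc chain a∈A c<a) = snoc (lower-floor K′≤K chain) a∈A c<a

  _++_ : ∀ {K c n d m} → Chain K c n → Chain n d m → Chain K d (n + m)
  lower ++ single a∈A n<a = snoc lower a∈A (≤-<-trans (top≤sum lower) n<a)
  _++_ {n = n} lower (snoc {z = z} {a = a} upper a∈A c<a) =
    subst (Chain _ _) (+-assoc n z a) (snoc (lower ++ upper) a∈A c<a)

  top≮top : ∀ {K K′ c c′ z} → Chain K c z → Chain K′ c′ z → ¬ c < c′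
  top≮top {K} {c = c} {c′} {z} chain chain′ c<c′ = <-irrefl refl (begin-strict
    c′     ≤⟨ top≤sum chain′ ⟩
    z      ≤⟨ m≤n+m z K ⟩
    K + z  <⟨ floor+sum<top+top chain ⟩
    c + c  <⟨ A-lacunary (top∈A chain) (top∈A chain′) c<c′ ⟩
    c′     ∎)
    where open ≤-Reasoning

  top-unique : ∀ {K K′ c c′ z} → Chain K c z → Chain K′ c′ z → c ≡ c′
  top-unique {c = c} {c′} chain chain′ with <-cmp c c′
  ... | tri≈ _ c≡c′ _ = c≡c′
  ... | tri< c<c′ _ _ = ⊥-elim (top≮top chain chain′ c<c′)
  ... | tri> _ _ c′<c = ⊥-elim (top≮top chain′ chain c′<c)

  _⊏_ : ℕ → ℕ → Set
  x ⊏ y = ∃[ s ] ChainSum x s × y ≡ x + s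

  prefixes-comparable : ∀ {x x′ c c′ d d′ y y′} → Chain 0 c x → Chain 0 c′ x′ →
    Chain x d y → Chain x′ d′ y′ → x + y ≡ x′ + y′ → x ≡ x′ ⊎ x ⊏ x′ ⊎ x′ ⊏ x
  prefixes-comparable lower lower′ upper upper′ e
    with top-unique (lower ++ upper) (subst (Chain 0 _) (sym e) (lower′ ++ upper′))
  prefixes-comparable {x} {x′} _ _ (single _ _) (single _ _) e | refl =
    inj₁ (+-cancelʳ-≡ _ x x′ e)
  prefixes-comparable {x} {x′} _ _ (single {a} _ _) (snoc {z = z′} upper′ _ _) e | refl =
    inj₂ (inj₂ (z′ , (_ , upper′) ,
      +-cancelʳ-≡ a x (x′ + z′) (trans e (sym (+-assoc x′ z′ a)))))
  prefixes-comparable {x} {x′} _ _ (snoc {z = z} {a = a} upper _ _) (single _ _) e | refl =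
    inj₂ (inj₁ (z , (_ , upper) , sym (+-cancelʳ-≡ a (x + z) x′ (trans (+-assoc x z a) e))))
  prefixes-comparable {x} {x′} lower lower′
    (snoc {z = z} {a = a} upper _ _) (snoc {z = z′} upper′ _ _) e | refl =
    prefixes-comparable lower lower′ upper upper′ (+-cancelʳ-≡ a (x + z) (x′ + z′)
      (trans (+-assoc x z a) (trans e (sym (+-assoc x′ z′ a)))))

  Antichain : Pred ℕ 0ℓ → Set
  Antichain P = ∀ {x y} → P x → x ⊏ y → ¬ P y

  record ChainUltrafilter (w : Family) : Set₁ where
    field
      isUltrafilter  : IsUltrafilter w
      chainSums∈     : ∀ K → w (ChainSum K)
      core           : Pred ℕ 0ℓ
      core∈          : w core
      core⊆chainSums : core ⊆ ChainSum 0
      core-antichain : Antichain core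

  open ChainUltrafilter

  chainUltrafilter-resp-≈ : ∀ {w v} → w ≈ v → ChainUltrafilter w → ChainUltrafilter v
  chainUltrafilter-resp-≈ w≈v W = record
    { isUltrafilter  = isUltrafilter-resp-≈ w≈v (isUltrafilter W)
    ; chainSums∈     = λ K → proj₁ (w≈v _) (chainSums∈ W K)
    ; core           = core W
    ; core∈          = proj₁ (w≈v _) (core∈ W)
    ; core⊆chainSums = core⊆chainSums W
    ; core-antichain = core-antichain W
    }

  base-chainUltrafilter : ∀ {p} → IsUltrafilter p → NonPrincipal p → p A → ChainUltrafilter p
  base-chainUltrafilter P np A∈p = record
    { isUltrafilter  = P
    ; chainSums∈     = λ K → upward P _ _ singleton (inter P _ _ A∈p (nonPrincipal⇒>∈ P np K))
    ; core           = λ x → A x × 0 < x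
    ; core∈          = inter P _ _ A∈p (nonPrincipal⇒>∈ P np 0)
    ; core⊆chainSums = singleton
    ; core-antichain = antichain
    }
    where
    singleton : ∀ {K x} → A x × K < x → ChainSum K x
    singleton (x∈A , K<x) = _ , single x∈A K<x

    antichain : Antichain (λ x → A x × 0 < x)
    antichain (_ , 0<x) (s , (c , chain) , refl) (x+s∈A , _) =
      <-asym (floor+sum<top+top chain)
             (A-lacunary (top∈A chain) x+s∈A (≤-<-trans (top≤sum chain) (m<n+m s 0<x)))

  ⨁-chainUltrafilter : ∀ {u us} → ChainUltrafilter u → (∀ n → ChainUltrafilter (us n)) →
                       ChainUltrafilter (⨁ u us)
  ⨁-chainUltrafilter {u} {us} U Us = record
    { isUltrafilter  = ⨁-isUltrafilter (isUltrafilter U) (λ n → isUltrafilter (Us n))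
    ; chainSums∈     = λ K → upward (isUltrafilter U) _ _
        (λ {n} (_ , lower) → upward (isUltrafilter (Us n)) _ _
                                (λ (_ , upper) → _ , lower ++ upper) (chainSums∈ (Us n) n))
        (chainSums∈ U K)
    ; core           = Q
    ; core∈          = upward (isUltrafilter U) _ _
        (λ {x} x∈core → upward (isUltrafilter (Us x)) _ _
                          (λ (y∈core , y∈chainSum) → x , _ , refl , x∈core , y∈core , y∈chainSum)
                          (inter (isUltrafilter (Us x)) _ _ (core∈ (Us x)) (chainSums∈ (Us x) x)))
        (core∈ U)
    ; core⊆chainSums = λ { (x , y , refl , x∈core , _ , (_ , upper)) →
                           _ , proj₂ (core⊆chainSums U x∈core) ++ upper }
    ; core-antichain = antichain
    }
    where
    Q : Pred ℕ 0ℓ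
    Q z = ∃[ x ] ∃[ y ] z ≡ x + y × core U x × core (Us x) y × ChainSum x y

    antichain : Antichain Q
    antichain (x , y , refl , x∈ , y∈ , (_ , upper)) (s , (_ , extension) , refl)
              (x′ , y′ , e , x′∈ , y′∈ , (_ , upper′))
      with prefixes-comparable (proj₂ (core⊆chainSums U x∈)) (proj₂ (core⊆chainSums U x′∈))
             (upper ++ lower-floor (m≤n+m y x) extension) upper′ (trans (sym (+-assoc x y s)) e)
    ... | inj₁ refl =
      core-antichain (Us x) y∈
        (s , (_ , lower-floor (m≤n+m y x) extension) ,
         +-cancelˡ-≡ x _ _ (trans (sym e) (+-assoc x y s)))
        y′∈
    ... | inj₂ (inj₁ x⊏x′) = core-antichain U x∈ x⊏x′ x′∈
    ... | inj₂ (inj₂ x′⊏x) = core-antichain U x′∈ x′⊏x x∈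

  ⊹-chainUltrafilter : ∀ {u v} → ChainUltrafilter u → ChainUltrafilter v →
                       ChainUltrafilter (u ⊹ v)
  ⊹-chainUltrafilter U V = ⨁-chainUltrafilter U (λ _ → V)

  pow-chainUltrafilter : ∀ {u} → ChainUltrafilter u → ∀ n → ChainUltrafilter (pow (suc n) u)
  pow-chainUltrafilter U zero    = U
  pow-chainUltrafilter U (suc n) = ⊹-chainUltrafilter U (pow-chainUltrafilter U n)

  ℱ-chainUltrafilter : ∀ {p w} → ChainUltrafilter p → Inℱ p w → ChainUltrafilter w
  ℱ-chainUltrafilter P (base w≈p) = chainUltrafilter-resp-≈ (≈-sym w≈p) P
  ℱ-chainUltrafilter P (sum _ _ u∈ℱ us∈ℱ w≈⨁) =
    chainUltrafilter-resp-≈ (≈-sym w≈⨁)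
      (⨁-chainUltrafilter (ℱ-chainUltrafilter P u∈ℱ) (λ n → ℱ-chainUltrafilter P (us∈ℱ n)))

  w≉w⊹v : ∀ {w v} → ChainUltrafilter w → ChainUltrafilter v → ¬ w ≈ w ⊹ v
  w≉w⊹v {w} {v} W V w≈w⊹v =
    Empty⇒∉ (isUltrafilter W) empty
      (inter (isUltrafilter W) _ _ (core∈ W) (proj₁ (w≈w⊹v (core W)) (core∈ W)))
    where
    empty : Empty (λ x → core W x × v (λ y → core W (x + y)))
    empty x (x∈core , shifted∈v) =
      Empty⇒∉ (isUltrafilter V)
        (λ y (x+y∈core , y∈chainSum) → core-antichain W x∈core (y , y∈chainSum , refl) x+y∈core)
        (inter (isUltrafilter V) _ _ shifted∈v (chainSums∈ V x))

theorem2p17 : (p : Family) → IsQPoint p → (u : Family) → Inℱ p u →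
    (n m : ℕ) → .{{_ : NonZero n}} → .{{_ : NonZero m}} →
      (pow n u ≈ pow m u → n ≡ m) × (n ≡ m → pow n u ≈ pow m u)
theorem2p17 p p-isQPoint@(P , p-nonPrincipal , _) u u∈ℱ n m
  with qPoint⇒lacunary p-isQPoint
... | A , A∈p , A-lacunary =
  pow-injective (ChainUltrafilter.isUltrafilter U)
    (λ k l → w≉w⊹v (pow-chainUltrafilter U k) (pow-chainUltrafilter U l)) n m
  , λ { refl → ≈-refl }
  where
  open Chains A-lacunary

  U : ChainUltrafilter u
  U = ℱ-chainUltrafilter (base-chainUltrafilter P p-nonPrincipal A∈p) u∈ℱ
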